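{- Consider the three-hat game described in the context. Up to the equivalence described in the context, there is a unique optimal strategy (one maximizing the winning probability) for $p=\tfrac12$, namely the symmetric strategy in which both players use the map $g$ with $g(\{1\})=1$, $g(\{2\})=3$, $g(\{1,2\})=1$, $g(\{3\})=2$, $g(\{1,3\})=2$, $g(\{2,3\})=3$ (and $g(\emptyset)$, $g(\{1,2,3\})$ arbitrary). Furthermore, this strategy is optimal for every $p\in(0,1)$.
   Context: The three-hat game: two players each wear three hats at positions $1,2,3$; each hat is independently white with probability $p$ and black with probability $1-p$, all six hats mutually independent. Each player sees the other's hats but not their own. A strategy is a pair $(f_1,f_2)$ of maps $f_i:2^{\{1,2,3\}}\to\{1,2,3\}$, where the input is the set of positions of white hats on the partner's head and the output is the position player $i$ points to on their own head. The players win if both chosen hats are white. Two strategies are considered equivalent if one can be obtained from the other by a combination of: (1) changing the values $f_i(\emptyset)$ and $f_i(\{1,2,3\})$ (the choices made when the partner's hats are all of one color), and (2) renumbering the hats, i.e. for permutations $\sigma_1,\sigma_2$ of $\{1,2,3\}$, replacing $(f_1,f_2)$ by $(\sigma_1\circ f_1\circ\sigma_2^{ -1},\ \sigma_2\circ f_2\circ\sigma_1^{ -1})$ (with $\sigma$ acting on subsets elementwise).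
   Formalization: The parameter p in the claim that the strategy is optimal for every $p\in(0,1)$ ranges over the rationals only. -}

module Defs where

open import Data.Bool using (Bool; true; false; _∧_)
open import Data.Nat using (ℕ; zero; suc)
open import Data.Fin using (Fin; zero; suc)
open import Data.Fin.Subset using (Subset; ∣_∣; ⊥; ⊤)
open import Data.Fin.Permutation using (Permutation′; _⟨$⟩ʳ_; _⟨$⟩ˡ_)
open import Data.Vec using (Vec; []; _∷_; lookup; tabulate)
open import Data.List using (List; []; _∷_; map; concatMap)
open import Data.Rational using (ℚ; 0ℚ; 1ℚ; _+_; _*_; _-_; _≤_)
open import Data.Product using (_×_; _,_; Σ; proj₁; proj₂)
open import Relation.Binary.PropositionalEquality using (_≡_; _≢_)

-- A hat configuration on one head: the subset of positions (Fin 3) carrying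
-- a white hat.  A choice map f : 2^{1,2,3} → {1,2,3}.
HatSet : Set
HatSet = Subset 3

Map : Set
Map = HatSet → Fin 3

Strategy : Set
Strategy = Map × Map

allSubsets : (n : ℕ) → List (Subset n)
allSubsets zero = [] ∷ []
allSubsets (suc n) = concatMap (λ s → (true ∷ s) ∷ (false ∷ s) ∷ []) (allSubsets n)

sumℚ : List ℚ → ℚ
sumℚ [] = 0ℚ
sumℚ (x ∷ xs) = x + sumℚ xs

powℚ : ℚ → ℕ → ℚ
powℚ x zero = 1ℚ
powℚ x (suc n) = x * powℚ x n

headWeight : ℚ → HatSet → ℚ
headWeight p h = powℚ p ∣ h ∣ * powℚ (1ℚ - p) (3 Data.Nat.∸ ∣ h ∣)

-- Indicator of a win: player 1 sees h₂ and points at f₁ h₂ on own head h₁,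
-- player 2 sees h₁ and points at f₂ h₁ on own head h₂; both must be white.
wins : Strategy → HatSet → HatSet → Bool
wins (f₁ , f₂) h₁ h₂ = lookup h₁ (f₁ h₂) ∧ lookup h₂ (f₂ h₁)

indicator : Bool → ℚ
indicator true = 1ℚ
indicator false = 0ℚ

winProb : ℚ → Strategy → ℚ
winProb p s =
  sumℚ (concatMap (λ h₁ → map (λ h₂ →
          indicator (wins s h₁ h₂) * (headWeight p h₁ * headWeight p h₂))
        (allSubsets 3)) (allSubsets 3))

Optimal : ℚ → Strategy → Set
Optimal p s = ∀ (t : Strategy) → winProb p t ≤ winProb p s

image : Permutation′ 3 → HatSet → HatSet
image σ S = tabulate (λ j → lookup S (σ ⟨$⟩ˡ j))

preimage : Permutation′ 3 → HatSet → HatSet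
preimage σ S = tabulate (λ j → lookup S (σ ⟨$⟩ʳ j))

renumber : Permutation′ 3 → Permutation′ 3 → Strategy → Strategy
renumber σ₁ σ₂ (f₁ , f₂) =
  (λ S → σ₁ ⟨$⟩ʳ f₁ (preimage σ₂ S)) , (λ S → σ₂ ⟨$⟩ʳ f₂ (preimage σ₁ S))

AgreeOffTrivial : Map → Map → Set
AgreeOffTrivial f g = ∀ (S : HatSet) → S ≢ ⊥ → S ≢ ⊤ → f S ≡ g S

-- Equivalence of strategies: generated by (1) changing values at ∅ and
-- {1,2,3} and (2) renumbering.  Since renumbering fixes ∅ and {1,2,3} and
-- permutations form a group, the generated equivalence is exactly:
-- some renumbering of s agrees with t off ∅ and {1,2,3}.
Equivalent : Strategy → Strategy → Set
Equivalent s t = Σ (Permutation′ 3) λ σ₁ → Σ (Permutation′ 3) λ σ₂ →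
  AgreeOffTrivial (proj₁ (renumber σ₁ σ₂ s)) (proj₁ t) ×
  AgreeOffTrivial (proj₂ (renumber σ₁ σ₂ s)) (proj₂ t)

pos1 pos2 pos3 : Fin 3
pos1 = zero
pos2 = suc zero
pos3 = suc (suc zero)

-- The map g ; g(∅) = g({1,2,3}) = 1 is an arbitrary choice (irrelevant up
-- to equivalence).
g : Map
g (false ∷ false ∷ false ∷ []) = pos1
g (true  ∷ false ∷ false ∷ []) = pos1
g (false ∷ true  ∷ false ∷ []) = pos3
g (true  ∷ true  ∷ false ∷ []) = pos1
g (false ∷ false ∷ true  ∷ []) = pos2
g (true  ∷ false ∷ true  ∷ []) = pos2
g (false ∷ true  ∷ true  ∷ []) = pos3
g (true  ∷ true  ∷ true  ∷ []) = pos1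

symmetricG : Strategy
symmetricG = g , g

module Submission where

-- Group the 64 hat configurations into 16 blocks by the numbers (k , l) of white hats on the
-- two heads.  All configurations of a block have the same probability, so the winning
-- probability is a combination, with positive coefficients, of the numbers of configurations
-- won in each block.  Whether a configuration of block (k , l) is won depends only on the
-- answers of player 1 to the sets of size l and of player 2 to the sets of size k, so each
-- block count is maximised separately by a finite search, and g attains all 16 maxima at
-- once: it is optimal for every p.  Conversely, for 0 < p < 1 an optimal strategy must attain
-- every maximum, and a second search shows that the maxima of the four blocks with
-- k , l ∈ {1 , 2} already force it to be a renumbering of g away from ∅ and {1,2,3}.

open import Defs
open import Data.Rational using (ℚ; 0ℚ; 1ℚ; ½; _<_)
open import Data.Product using (_×_)

open import Data.Bool using (Bool; true; false; _∧_; if_then_else_)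
import Data.Bool.Properties as Bool
open import Data.Fin using (Fin; zero; suc; toℕ; fromℕ<; combine; remQuot)
open import Data.Fin.Patterns using (0F; 1F; 2F; 3F)
open import Data.Fin.Permutation using (Permutation′; id; transpose; _∘ₚ_; _⟨$⟩ʳ_)
open import Data.Fin.Properties using (_≟_; all?; toℕ-fromℕ<; remQuot-combine; combine-remQuot)
open import Data.Fin.Subset using (⊥; ⊤)
open import Data.Fin.Subset.Properties using (∣p∣≤n)
open import Data.List as List using (List; []; _∷_; map; filter; length; cartesianProduct; allFin)
open import Data.List.Properties using (map-cong)
open import Data.List.Relation.Unary.Any using (Any; any?; satisfied)
open import Data.Nat as ℕ using (ℕ; zero; suc; _∸_; s≤s; z≤n)
import Data.Nat.Properties as ℕ
open import Data.Product using (_,_; proj₁; proj₂; uncurry)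
open import Data.Rational using (_+_; _*_; _-_; -_; _≤_; positive)
import Data.Rational.Properties as ℚ
open import Data.Vec using (Vec; []; _∷_; lookup; tabulate)
import Data.Vec.Properties as Vec
open import Function using (_∘_)
open import Relation.Binary.PropositionalEquality
  using (_≡_; _≗_; refl; sym; trans; cong; cong₂; subst; subst₂; module ≡-Reasoning)
open import Relation.Nullary.Decidable using (Dec; does; map′; ¬?; _×-dec_; _→-dec_; from-yes)
open import Relation.Unary using (Decidable)
open import Algebra.Properties.CommutativeMonoid.Sum ℚ.+-0-commutativeMonoid
  using (sum; sum-syntax; ∑-distrib-+; sum-cong-≗; sum-replicate-zero)
open import Algebra.Properties.Monoid.Mult ℚ.+-0-monoid
  using (×-homo-1; ×-homo-+) renaming (_×_ to _·_)

Exhaustible : Set → Set₁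
Exhaustible A = ∀ {P : A → Set} → Decidable P → Dec (∀ x → P x)

all-Bool? : Exhaustible Bool
all-Bool? P? = map′ (λ (t , f) → λ { true → t ; false → f }) (λ h → h true , h false) (P? true ×-dec P? false)

all-Vec? : ∀ {A} → Exhaustible A → ∀ {n} → Exhaustible (Vec A n)
all-Vec? all-A? {zero}  P? = map′ (λ p → λ { [] → p }) (λ h → h []) (P? [])
all-Vec? all-A? {suc n} P? = map′ (λ h → λ { (x ∷ v) → h x v }) (λ h x v → h (x ∷ v))
  (all-A? λ x → all-Vec? all-A? λ v → P? (x ∷ v))

bit : Bool → ℕ
bit b = if b then 1 else 0

count : {A : Set} → (A → Bool) → List A → ℕ
count P []       = 0
count P (x ∷ xs) = bit (P x) ℕ.+ count P xs

bit-· : ∀ b x → bit b · x ≡ indicator b * x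
bit-· true  x = trans (×-homo-1 x) (sym (ℚ.*-identityˡ x))
bit-· false x = sym (ℚ.*-zeroˡ x)

∑-δ : ∀ {n} (j : Fin n) b (w : Fin n → ℚ) →
      ∑[ i < n ] (bit (does (j ≟ i) ∧ b) · w i) ≡ indicator b * w j
∑-δ {suc n} zero    b w = begin
  bit b · w zero + ∑[ i < n ] 0ℚ ≡⟨ cong₂ _+_ (bit-· b (w zero)) (sum-replicate-zero n) ⟩
  indicator b * w zero + 0ℚ    ≡⟨ ℚ.+-identityʳ _ ⟩
  indicator b * w zero         ∎
  where open ≡-Reasoning
∑-δ {suc n} (suc j) b w = trans (ℚ.+-identityˡ _) (∑-δ j b (w ∘ suc))

module _ {X : Set} {n : ℕ} (class : X → Fin n) where

  classCount : (X → Bool) → List X → Fin n → ℕ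
  classCount P xs i = count (λ x → does (class x ≟ i) ∧ P x) xs

  sumℚ-by-class : ∀ (P : X → Bool) (w : Fin n → ℚ) xs →
    sumℚ (map (λ x → indicator (P x) * w (class x)) xs) ≡ ∑[ i < n ] (classCount P xs i · w i)
  sumℚ-by-class P w []       = sym (sum-replicate-zero n)
  sumℚ-by-class P w (x ∷ xs) = begin
    indicator (P x) * w (class x) + sumℚ (map (λ x → indicator (P x) * w (class x)) xs)
      ≡⟨ cong₂ _+_ (sym (∑-δ (class x) (P x) w)) (sumℚ-by-class P w xs) ⟩
    ∑[ i < n ] (δ i · w i) + ∑[ i < n ] (classCount P xs i · w i)
      ≡⟨ sym (∑-distrib-+ (λ i → δ i · w i) (λ i → classCount P xs i · w i)) ⟩
    ∑[ i < n ] (δ i · w i + classCount P xs i · w i)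
      ≡⟨ sum-cong-≗ (λ i → sym (×-homo-+ (w i) (δ i) (classCount P xs i))) ⟩
    ∑[ i < n ] (classCount P (x ∷ xs) i · w i)
      ∎
    where
    open ≡-Reasoning
    δ : Fin n → ℕ
    δ i = bit (does (class x ≟ i) ∧ P x)

·-nonNeg : ∀ {x} → 0ℚ ≤ x → ∀ m → 0ℚ ≤ m · x
·-nonNeg 0≤x zero    = ℚ.≤-refl
·-nonNeg 0≤x (suc m) = ℚ.+-mono-≤ 0≤x (·-nonNeg 0≤x m)

·-monoˡ-≤ : ∀ {x m n} → 0ℚ ≤ x → m ℕ.≤ n → m · x ≤ n · x
·-monoˡ-≤ {n = n} 0≤x z≤n       = ·-nonNeg 0≤x n
·-monoˡ-≤ {x}     0≤x (s≤s m≤n) = ℚ.+-monoʳ-≤ x (·-monoˡ-≤ 0≤x m≤n)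

·-monoˡ-< : ∀ {x m n} → 0ℚ < x → m ℕ.< n → m · x < n · x
·-monoˡ-< {n = suc n} 0<x (s≤s z≤n)       = ℚ.+-mono-<-≤ 0<x (·-nonNeg (ℚ.<⇒≤ 0<x) n)
·-monoˡ-< {x}         0<x (s≤s (s≤s m<n)) = ℚ.+-monoʳ-< x (·-monoˡ-< 0<x (s≤s m<n))

∑-mono-≤ : ∀ {n} {f g : Fin n → ℚ} → (∀ i → f i ≤ g i) → sum f ≤ sum g
∑-mono-≤ {zero}  f≤g = ℚ.≤-refl
∑-mono-≤ {suc n} f≤g = ℚ.+-mono-≤ (f≤g zero) (∑-mono-≤ (f≤g ∘ suc))

∑-mono-< : ∀ {n} {f g : Fin n → ℚ} → (∀ i → f i ≤ g i) → ∀ j → f j < g j → sum f < sum g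
∑-mono-< f≤g zero    fj<gj = ℚ.+-mono-<-≤ fj<gj (∑-mono-≤ (f≤g ∘ suc))
∑-mono-< f≤g (suc j) fj<gj = ℚ.+-mono-≤-< (f≤g zero) (∑-mono-< (f≤g ∘ suc) j fj<gj)

layerOf : HatSet → Fin 4
layerOf h = fromℕ< (s≤s (∣p∣≤n h))

layer : Fin 4 → List HatSet
layer k = filter (λ h → layerOf h ≟ k) (allSubsets 3)

block : HatSet × HatSet → Fin 16
block (h₁ , h₂) = combine (layerOf h₁) (layerOf h₂)

configurations : List (HatSet × HatSet)
configurations = cartesianProduct (allSubsets 3) (allSubsets 3)

blockWins : Strategy → Fin 16 → ℕ
blockWins s = classCount block (uncurry (wins s)) configurations

layerWeight : ℚ → Fin 4 → ℚ
layerWeight p k = powℚ p (toℕ k) * powℚ (1ℚ - p) (3 ∸ toℕ k)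

blockWeight : ℚ → Fin 16 → ℚ
blockWeight p i = layerWeight p (proj₁ (remQuot {4} 4 i)) * layerWeight p (proj₂ (remQuot {4} 4 i))

headWeight≡layerWeight : ∀ p h → headWeight p h ≡ layerWeight p (layerOf h)
headWeight≡layerWeight p h =
  cong (λ n → powℚ p n * powℚ (1ℚ - p) (3 ∸ n)) (sym (toℕ-fromℕ< (s≤s (∣p∣≤n h))))

winProb-by-blocks : ∀ p s → winProb p s ≡ ∑[ i < 16 ] (blockWins s i · blockWeight p i)
winProb-by-blocks p s = begin
  winProb p s
    -- winProb p s unfolds to the same 64-term sum as a sum over configurations
    ≡⟨ cong sumℚ (map-cong weightOfBlock configurations) ⟩
  sumℚ (map (λ x → indicator (uncurry (wins s) x) * blockWeight p (block x)) configurations)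
    ≡⟨ sumℚ-by-class block (uncurry (wins s)) (blockWeight p) configurations ⟩
  ∑[ i < 16 ] (blockWins s i · blockWeight p i)
    ∎
  where
  open ≡-Reasoning
  weightOfBlock : ∀ x → indicator (uncurry (wins s) x) * (headWeight p (proj₁ x) * headWeight p (proj₂ x))
                      ≡ indicator (uncurry (wins s) x) * blockWeight p (block x)
  weightOfBlock (h₁ , h₂) = cong (indicator (wins s h₁ h₂) *_) (begin
    headWeight p h₁ * headWeight p h₂
      ≡⟨ cong₂ _*_ (headWeight≡layerWeight p h₁) (headWeight≡layerWeight p h₂) ⟩
    layerWeight p (layerOf h₁) * layerWeight p (layerOf h₂)
      ≡⟨ cong (λ (k , l) → layerWeight p k * layerWeight p l) (sym (remQuot-combine (layerOf h₁) (layerOf h₂))) ⟩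
    blockWeight p (block (h₁ , h₂))
      ∎)

*-pos : ∀ {x y} → 0ℚ < x → 0ℚ < y → 0ℚ < x * y
*-pos {x} {y} 0<x 0<y = ℚ.positive⁻¹ (x * y) {{ℚ.pos*pos⇒pos x {{positive 0<x}} y {{positive 0<y}}}}

powℚ-pos : ∀ {x} → 0ℚ < x → ∀ n → 0ℚ < powℚ x n
powℚ-pos 0<x zero    = ℚ.positive⁻¹ 1ℚ
powℚ-pos 0<x (suc n) = *-pos 0<x (powℚ-pos 0<x n)

layerWeight-pos : ∀ {p} → 0ℚ < p → p < 1ℚ → ∀ k → 0ℚ < layerWeight p k
layerWeight-pos {p} 0<p p<1 k = *-pos (powℚ-pos 0<p (toℕ k)) (powℚ-pos 0<1-p (3 ∸ toℕ k))
  where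
  0<1-p : 0ℚ < 1ℚ - p
  0<1-p = subst (_< 1ℚ - p) (ℚ.+-inverseʳ p) (ℚ.+-monoˡ-< (- p) p<1)

blockWeight-pos : ∀ {p} → 0ℚ < p → p < 1ℚ → ∀ i → 0ℚ < blockWeight p i
blockWeight-pos 0<p p<1 i =
  *-pos (layerWeight-pos 0<p p<1 (proj₁ (remQuot {4} 4 i))) (layerWeight-pos 0<p p<1 (proj₂ (remQuot {4} 4 i)))

_↾_ : Map → (k : Fin 4) → Vec (Fin 3) (length (layer k))
f ↾ k = tabulate (f ∘ List.lookup (layer k))

winsBetween : (k l : Fin 4) → Vec (Fin 3) (length (layer l)) → Vec (Fin 3) (length (layer k)) → ℕ
winsBetween k l r₁ r₂ = count wonAt (cartesianProduct (allFin _) (allFin _))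
  where
  wonAt : Fin (length (layer k)) × Fin (length (layer l)) → Bool
  wonAt (i , j) = lookup (List.lookup (layer k) i) (lookup r₁ j) ∧ lookup (List.lookup (layer l) j) (lookup r₂ i)

-- By computation: classCount tests the block before the win, so configurations outside the
-- block contribute 0 definitionally, and the others come in the order of layer k × layer l.
blockWins-by-answers : ∀ k l s → blockWins s (combine k l) ≡ winsBetween k l (proj₁ s ↾ l) (proj₂ s ↾ k)
blockWins-by-answers 0F 0F s = refl
blockWins-by-answers 0F 1F s = refl
blockWins-by-answers 0F 2F s = refl
blockWins-by-answers 0F 3F s = refl
blockWins-by-answers 1F 0F s = refl
blockWins-by-answers 1F 1F s = refl
blockWins-by-answers 1F 2F s = refl
blockWins-by-answers 1F 3F s = refl
blockWins-by-answers 2F 0F s = refl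
blockWins-by-answers 2F 1F s = refl
blockWins-by-answers 2F 2F s = refl
blockWins-by-answers 2F 3F s = refl
blockWins-by-answers 3F 0F s = refl
blockWins-by-answers 3F 1F s = refl
blockWins-by-answers 3F 2F s = refl
blockWins-by-answers 3F 3F s = refl

winsBetween-≤ : ∀ k l r₁ r₂ → winsBetween k l r₁ r₂ ℕ.≤ winsBetween k l (g ↾ l) (g ↾ k)
winsBetween-≤ = from-yes (all? λ k → all? λ l → all-Vec? all? λ r₁ → all-Vec? all? λ r₂ →
  winsBetween k l r₁ r₂ ℕ.≤? winsBetween k l (g ↾ l) (g ↾ k))

blockWins-≤ : ∀ s i → blockWins s i ℕ.≤ blockWins symmetricG i
blockWins-≤ s i =
  subst (λ i → blockWins s i ℕ.≤ blockWins symmetricG i) (combine-remQuot {4} 4 i) (bound (remQuot {4} 4 i))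
  where
  bound : ∀ ((k , l) : Fin 4 × Fin 4) → blockWins s (combine k l) ℕ.≤ blockWins symmetricG (combine k l)
  bound (k , l) = subst₂ ℕ._≤_ (sym (blockWins-by-answers k l s)) (sym (blockWins-by-answers k l symmetricG))
                         (winsBetween-≤ k l (proj₁ s ↾ l) (proj₂ s ↾ k))

symmetricG-optimal : ∀ {p} → 0ℚ < p → p < 1ℚ → Optimal p symmetricG
symmetricG-optimal {p} 0<p p<1 s = begin
  winProb p s                                            ≡⟨ winProb-by-blocks p s ⟩
  ∑[ i < 16 ] (blockWins s i · blockWeight p i)
    ≤⟨ ∑-mono-≤ (λ i → ·-monoˡ-≤ (ℚ.<⇒≤ (blockWeight-pos 0<p p<1 i)) (blockWins-≤ s i)) ⟩
  ∑[ i < 16 ] (blockWins symmetricG i · blockWeight p i) ≡⟨ winProb-by-blocks p symmetricG ⟨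
  winProb p symmetricG                                   ∎
  where open ℚ.≤-Reasoning

optimal⇒blockWins-maximal : ∀ {p} → 0ℚ < p → p < 1ℚ → ∀ s → Optimal p s →
                            ∀ i → blockWins s i ≡ blockWins symmetricG i
optimal⇒blockWins-maximal {p} 0<p p<1 s optimal i =
  ℕ.≤-antisym (blockWins-≤ s i) (ℕ.≮⇒≥ λ lt → ℚ.<-irrefl refl (ℚ.≤-<-trans (optimal symmetricG) (loses lt)))
  where
  loses : blockWins s i ℕ.< blockWins symmetricG i → winProb p s < winProb p symmetricG
  loses lt = begin-strict
    winProb p s                                            ≡⟨ winProb-by-blocks p s ⟩
    ∑[ j < 16 ] (blockWins s j · blockWeight p j)
      <⟨ ∑-mono-< (λ j → ·-monoˡ-≤ (ℚ.<⇒≤ (blockWeight-pos 0<p p<1 j)) (blockWins-≤ s j))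
                  i (·-monoˡ-< (blockWeight-pos 0<p p<1 i) lt) ⟩
    ∑[ j < 16 ] (blockWins symmetricG j · blockWeight p j) ≡⟨ winProb-by-blocks p symmetricG ⟨
    winProb p symmetricG                                   ∎
    where open ℚ.≤-Reasoning

-- The answers on a layer are listed in the order of layer, inherited from allSubsets 3:
-- {3}, {2}, {1} and {2,3}, {1,3}, {1,2}.
fromLayers : Fin 3 → Vec (Fin 3) 3 → Vec (Fin 3) 3 → Fin 3 → Map
fromLayers e a b u (false ∷ false ∷ false ∷ []) = e
fromLayers e a b u (false ∷ false ∷ true  ∷ []) = lookup a 0F
fromLayers e a b u (false ∷ true  ∷ false ∷ []) = lookup a 1F
fromLayers e a b u (true  ∷ false ∷ false ∷ []) = lookup a 2F
fromLayers e a b u (false ∷ true  ∷ true  ∷ []) = lookup b 0F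
fromLayers e a b u (true  ∷ false ∷ true  ∷ []) = lookup b 1F
fromLayers e a b u (true  ∷ true  ∷ false ∷ []) = lookup b 2F
fromLayers e a b u (true  ∷ true  ∷ true  ∷ []) = u

byLayers : Map → Map
byLayers f = fromLayers (f ⊥) (f ↾ 1F) (f ↾ 2F) (f ⊤)

byLayers-≗ : ∀ f → f ≗ byLayers f
byLayers-≗ f (false ∷ false ∷ false ∷ []) = refl
byLayers-≗ f (false ∷ false ∷ true  ∷ []) = refl
byLayers-≗ f (false ∷ true  ∷ false ∷ []) = refl
byLayers-≗ f (true  ∷ false ∷ false ∷ []) = refl
byLayers-≗ f (false ∷ true  ∷ true  ∷ []) = refl
byLayers-≗ f (true  ∷ false ∷ true  ∷ []) = refl
byLayers-≗ f (true  ∷ true  ∷ false ∷ []) = refl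
byLayers-≗ f (true  ∷ true  ∷ true  ∷ []) = refl

Renumbers : Strategy → Strategy → Permutation′ 3 → Permutation′ 3 → Set
Renumbers s t σ₁ σ₂ = AgreeOffTrivial (proj₁ (renumber σ₁ σ₂ s)) (proj₁ t)
                    × AgreeOffTrivial (proj₂ (renumber σ₁ σ₂ s)) (proj₂ t)

Equivalent-respects-≗ : ∀ {f₁ f₂ f₁′ f₂′ t} → f₁ ≗ f₁′ → f₂ ≗ f₂′ →
                        Equivalent (f₁′ , f₂′) t → Equivalent (f₁ , f₂) t
Equivalent-respects-≗ f₁≗f₁′ f₂≗f₂′ (σ₁ , σ₂ , agree₁ , agree₂) =
  σ₁ , σ₂ , (λ S S≢⊥ S≢⊤ → trans (cong (σ₁ ⟨$⟩ʳ_) (f₁≗f₁′ _)) (agree₁ S S≢⊥ S≢⊤))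
          , (λ S S≢⊥ S≢⊤ → trans (cong (σ₂ ⟨$⟩ʳ_) (f₂≗f₂′ _)) (agree₂ S S≢⊥ S≢⊤))

agreeOffTrivial? : ∀ f f′ → Dec (AgreeOffTrivial f f′)
agreeOffTrivial? f f′ = all-Vec? all-Bool? λ S → ¬? (S ≟ˢ ⊥) →-dec ¬? (S ≟ˢ ⊤) →-dec f S ≟ f′ S
  where _≟ˢ_ = Vec.≡-dec Bool._≟_

permutations₃ : List (Permutation′ 3)
permutations₃ = id ∷ transpose 0F 1F ∷ transpose 0F 2F ∷ transpose 1F 2F
              ∷ (transpose 0F 1F ∘ₚ transpose 1F 2F) ∷ (transpose 1F 2F ∘ₚ transpose 0F 1F) ∷ []

RenumbersWithin : Strategy → Strategy → Set
RenumbersWithin s t = Any (λ σ₁ → Any (Renumbers s t σ₁) permutations₃) permutations₃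

renumbersWithin? : ∀ s t → Dec (RenumbersWithin s t)
renumbersWithin? s t = any? (λ σ₁ → any? (λ σ₂ →
  agreeOffTrivial? (proj₁ (renumber σ₁ σ₂ s)) (proj₁ t) ×-dec
  agreeOffTrivial? (proj₂ (renumber σ₁ σ₂ s)) (proj₂ t))
  permutations₃) permutations₃

RenumbersWithin⇒Equivalent : ∀ {s t} → RenumbersWithin s t → Equivalent s t
RenumbersWithin⇒Equivalent found =
  let σ₁ , found₂ = satisfied found
      σ₂ , agree  = satisfied found₂
  in σ₁ , σ₂ , agree

MaximalOn : (k l : Fin 4) → Vec (Fin 3) (length (layer l)) → Vec (Fin 3) (length (layer k)) → Set
MaximalOn k l r₁ r₂ = winsBetween k l r₁ r₂ ≡ winsBetween k l (g ↾ l) (g ↾ k)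

-- The values at ∅ and {1,2,3} stay variables, since the search never inspects them.  The
-- hypotheses are interleaved with the quantifiers so that the search only enumerates answers
-- on a further layer once the blocks seen so far are maximal.
maximal-middle-blocks-rigid : ∀ e₁ u₁ e₂ u₂ (a₁ a₂ : Vec (Fin 3) 3) → MaximalOn 1F 1F a₁ a₂ →
  ∀ b₁ → MaximalOn 1F 2F b₁ a₂ → ∀ b₂ → MaximalOn 2F 1F a₁ b₂ → MaximalOn 2F 2F b₁ b₂ →
  RenumbersWithin (fromLayers e₁ a₁ b₁ u₁ , fromLayers e₂ a₂ b₂ u₂) symmetricG
maximal-middle-blocks-rigid e₁ u₁ e₂ u₂ = from-yes
  (all-Vec? all? λ a₁ → all-Vec? all? λ a₂ → maximalOn? 1F 1F a₁ a₂ →-dec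
   all-Vec? all? (λ b₁ → maximalOn? 1F 2F b₁ a₂ →-dec
   all-Vec? all? (λ b₂ → maximalOn? 2F 1F a₁ b₂ →-dec maximalOn? 2F 2F b₁ b₂ →-dec
   renumbersWithin? (fromLayers e₁ a₁ b₁ u₁ , fromLayers e₂ a₂ b₂ u₂) symmetricG)))
  where
  maximalOn? : ∀ k l r₁ r₂ → Dec (MaximalOn k l r₁ r₂)
  maximalOn? k l r₁ r₂ = winsBetween k l r₁ r₂ ℕ.≟ winsBetween k l (g ↾ l) (g ↾ k)

maximal-middle-blocks⇒Equivalent : ∀ f₁ f₂ →
  MaximalOn 1F 1F (f₁ ↾ 1F) (f₂ ↾ 1F) → MaximalOn 1F 2F (f₁ ↾ 2F) (f₂ ↾ 1F) →
  MaximalOn 2F 1F (f₁ ↾ 1F) (f₂ ↾ 2F) → MaximalOn 2F 2F (f₁ ↾ 2F) (f₂ ↾ 2F) →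
  Equivalent (f₁ , f₂) symmetricG
maximal-middle-blocks⇒Equivalent f₁ f₂ max₁₁ max₁₂ max₂₁ max₂₂ =
  Equivalent-respects-≗ (byLayers-≗ f₁) (byLayers-≗ f₂) (RenumbersWithin⇒Equivalent {byLayers f₁ , byLayers f₂} found)
  where
  found : RenumbersWithin (byLayers f₁ , byLayers f₂) symmetricG
  found = maximal-middle-blocks-rigid (f₁ ⊥) (f₁ ⊤) (f₂ ⊥) (f₂ ⊤)
            (f₁ ↾ 1F) (f₂ ↾ 1F) max₁₁ (f₁ ↾ 2F) max₁₂ (f₂ ↾ 2F) max₂₁ max₂₂

optimal⇒Equivalent : ∀ {p} → 0ℚ < p → p < 1ℚ → ∀ s → Optimal p s → Equivalent s symmetricG
optimal⇒Equivalent 0<p p<1 s@(f₁ , f₂) optimal =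
  maximal-middle-blocks⇒Equivalent f₁ f₂ (maximal 1F 1F) (maximal 1F 2F) (maximal 2F 1F) (maximal 2F 2F)
  where
  maximal : ∀ k l → MaximalOn k l (f₁ ↾ l) (f₂ ↾ k)
  maximal k l = begin
    winsBetween k l (f₁ ↾ l) (f₂ ↾ k) ≡⟨ blockWins-by-answers k l s ⟨
    blockWins s (combine k l)          ≡⟨ optimal⇒blockWins-maximal 0<p p<1 s optimal (combine k l) ⟩
    blockWins symmetricG (combine k l) ≡⟨ blockWins-by-answers k l symmetricG ⟩
    winsBetween k l (g ↾ l) (g ↾ k)    ∎
    where open ≡-Reasoning

mainTheorem4 : ((s : Strategy) → Optimal ½ s → Equivalent s symmetricG) ×
    ((p : ℚ) → 0ℚ < p → p < 1ℚ → Optimal p symmetricG)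
mainTheorem4 = optimal⇒Equivalent {½} 0<½ ½<1 , λ p → symmetricG-optimal
  where
  0<½ : 0ℚ < ½
  0<½ = ℚ.positive⁻¹ ½
  ½<1 : ½ < 1ℚ
  ½<1 = from-yes (½ ℚ.<? 1ℚ)
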